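{- For every pattern $A$, every pathset $\mathcal{A}\in\mathcal{P}_A$, every $A$-respecting $S\subseteq V_k$ and every $z\in[n]^{\bar S}$, we have $\bar\chi_{A\upharpoonright S}(\mathcal{A}|^z_S)\le\bar\chi_A(\mathcal{A})$, where $\mathcal{A}|^z_S=\{y\in[n]^{V_A\cap S}:yz'\in\mathcal{A}\}$ with $z'=z_{V_A\setminus S}$.
   Context: Integers $n\ge1$, $k\ge2$; logs base 2. $V_k=\{v_0,\dots,v_k\}$, $E_k=\{v_iv_{i+1}:0\le i<k\}$; for $S\subseteq V_k$, $\bar S=V_k\setminus S$. Pattern graph $G=(V_G,E_G)$: $E_G\subseteq E_k$, $V_G$ the endpoints of $E_G$; $c(G)$ = number of components. $[n]^V$ = maps $V\to[n]$; $x_T$ restriction; $yz$ combined tuple. For $\mathcal{A}\subseteq[n]^V$: $\mu_T(\mathcal{A})=\max_{z\in[n]^{V\setminus T}}|\{y\in[n]^T:yz\in\mathcal{A}\}|/n^{|T|}$; join $\mathcal{A}\bowtie\mathcal{B}=\{x\in[n]^{V\cup W}:x_V\in\mathcal{A},x_W\in\mathcal{B}\}$. $\mathcal{P}_G$ = power set of $[n]^{V_G}$. $\varepsilon=1/\log k$, $\tilde n=n^{1-\varepsilon}$; $\mathcal{A}\in\mathcal{P}_G$ is $G$-small if $\mu_T(\mathcal{A})\le\tilde n^{ -t}$ for all $1\le t\le c(G)$ and all unions $T$ of $t$ components of $G$; $\mathcal{P}^{\mathrm{small}}_G$ the set of these. A pattern is the empty pattern $\emptyset$ or a rooted unordered binary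 tree with leaves labeled by elements of $E_k$; $G_A=(V_A,E_A)$ with $E_A$ the set of labels; $\mathcal{P}_A=\mathcal{P}_{G_A}$; atomic = one leaf; $\{B,C\}$ = root with subtrees $B,C$. $\bar\chi_\emptyset(\mathcal{A})=0$; $\bar\chi_A(\mathcal{A})=|\mathcal{A}|$ for atomic $A$; $\bar\chi_{\{B,C\}}(\mathcal{A})=\min\sum_i(\bar\chi_B(\mathcal{B}_i)+\bar\chi_C(\mathcal{C}_i))$ over finite sequences with $\mathcal{B}_i\in\mathcal{P}^{\mathrm{small}}_{G_B}$, $\mathcal{C}_i\in\mathcal{P}^{\mathrm{small}}_{G_C}$, $\mathcal{A}\subseteq\bigcup_i\mathcal{B}_i\bowtie\mathcal{C}_i$. $S\subseteq V_k$ is $A$-respecting if every leaf label $v_iv_{i+1}$ of $A$ has both endpoints in $S$ or both in $\bar S$ (equivalently $V_A\cap S$ is a union of components of $G_A$). For $A$-respecting $S$, $A\upharpoonright S$ is the pattern obtained from $A$ by deleting all leaves whose labels lie in $\bar S\times\bar S$, removing internal nodes with no remaining leaf descendants, and splicing out internal nodes left with a single child (so $\{B,C\}\upharpoonright S=\{B\upharpoonright S,C\upharpoonright S\}$ with $\{X,\emptyset\}=X$); its pattern graph is $G_A$ restricted to the components contained in $S$, with vertex set $V_A\cap S$. -}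

module Defs where

open import Level using (Level; Lift) renaming (zero to lzero; suc to lsuc)
open import Data.Bool using (Bool; true; false; if_then_else_)
open import Data.Nat using (ℕ; zero; suc; _+_; _*_; _^_; _≤_)
open import Data.Fin using (Fin; inject₁) renaming (suc to fsuc)
open import Data.Fin.Subset using (Subset; _∈_; _⊆_; _∪_; _∩_; ∁; ⁅_⁆; ∣_∣; inside; outside)
import Data.Fin.Subset as Sub
open import Data.Vec using (Vec; _∷_; _∷ʳ_; lookup)
open import Data.List using (List; length; map)
open import Data.Nat.ListAction using (sum)
open import Data.List.Relation.Unary.Any using (Any)
open import Data.Maybe using (Maybe; just; nothing)
open import Data.Product using (Σ; Σ-syntax; _×_; _,_)
open import Data.Unit using (⊤)
open import Relation.Binary.PropositionalEquality using (_≡_)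

-- Vertices V_k = {v_0,…,v_k} are Fin (suc k); edge v_i v_{i+1} is i : Fin k,
-- with endpoints inject₁ i (= v_i) and fsuc i (= v_{i+1}).

-- Tuples: a tuple in [n]^V (V ⊆ V_k) is represented by a total map
-- V_k → [n], considered up to agreement on V (n ≥ 1 is assumed in the
-- statement, so every tuple extends to a total map).
Asg : ℕ → ℕ → Set
Asg n k = Fin (suc k) → Fin n

AgreeOn : ∀ {n k} → Subset (suc k) → Asg n k → Asg n k → Set
AgreeOn V x y = ∀ v → v ∈ V → x v ≡ y v

-- A set of tuples over V (element of the power set of [n]^V) is a predicate
-- on total maps which only depends on the values on V.
Pred : ℕ → ℕ → Set₁
Pred n k = Asg n k → Set

IsPathset : ∀ {n k} → Subset (suc k) → Pred n k → Set
IsPathset V 𝒜 = ∀ x y → AgreeOn V x y → 𝒜 x → 𝒜 y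

-- |𝒜| ≤ m  for 𝒜 ⊆ [n]^V : 𝒜 is covered by at most m tuples (restricted to V).
CardLE : ∀ {n k} → Subset (suc k) → Pred n k → ℕ → Set
CardLE V 𝒜 m = Σ[ L ∈ List _ ] (length L ≤ m × (∀ x → 𝒜 x → Any (AgreeOn V x) L))

-- the tuple y z : equal to x on S and to z outside S
merge : ∀ {n k} → Subset (suc k) → Asg n k → Asg n k → Asg n k
merge S x z v = if lookup S v then x v else z v

-- V_G : endpoints of the edges in E
verts : ∀ {k} → Subset k → Subset (suc k)
verts E = (outside ∷ E) ∪ (E ∷ʳ outside)

-- v is the leftmost vertex of its component (within its path-component):
-- v = v_0, or the edge v_{i} v_{i+1} = v is not in E.  In a subgraph of a
-- path every component is a run of consecutive vertices, so the components
-- contained in T are counted by the leftmost vertices in T.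
leftmost : ∀ {k} → Subset k → Subset (suc k)
leftmost E = inside ∷ ∁ E

ncomp : ∀ {k} → Subset k → Subset (suc k) → ℕ
ncomp E T = ∣ T ∩ (leftmost E ∩ verts E) ∣

UnionOfComps : ∀ {k} → Subset k → Subset (suc k) → Set
UnionOfComps E T =
  T ⊆ verts E × (∀ i → i ∈ E → (inject₁ i ∈ T → fsuc i ∈ T) × (fsuc i ∈ T → inject₁ i ∈ T))

-- BoundOK n k m t c  ⇔  c ≤ n^m · ñ^(-t)  where ñ = n^(1-ε), ε = 1/log₂ k,
-- i.e. c ≤ n^(m - t + t/log₂ k).  (Real inequality with irrational exponent,
-- expressed in ℕ: equivalently log₂ k · log₂ (c n^t / n^m) ≤ t log₂ n, which
-- holds iff for all rationals a/b ≤ log₂ k and p/q ≤ log₂ (c n^t/n^m) one has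
-- (a/b)(p/q) ≤ t log₂ n.)
BoundOK : ℕ → ℕ → ℕ → ℕ → ℕ → Set
BoundOK n k m t c = ∀ a b p q → 1 ≤ b → 1 ≤ q →
  2 ^ a ≤ k ^ b → 2 ^ p * n ^ (m * q) ≤ c ^ q * n ^ (t * q) →
  2 ^ (a * p) ≤ n ^ (t * b * q)

-- μ_T(𝒜) ≤ ñ^(-t) : every fibre {y ∈ [n]^T : y z ∈ 𝒜} has at most
-- n^|T| ñ^(-t) elements.
MuLE : ∀ {n k} → Pred n k → Subset (suc k) → ℕ → Set
MuLE {n} {k} 𝒜 T t = ∀ (z : Asg n k) →
  Σ[ c ∈ ℕ ] (CardLE T (λ y → 𝒜 (merge T y z)) c × BoundOK n k ∣ T ∣ t c)

-- G-small: μ_T(𝒜) ≤ ñ^(-t) for every union T of t ≥ 1 components of G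
-- (t ≤ c(G) is automatic).
Small : ∀ {n k} → Subset k → Pred n k → Set
Small E 𝒜 = ∀ T → UnionOfComps E T → 1 ≤ ncomp E T → MuLE 𝒜 T (ncomp E T)

-- nonempty patterns: binary trees with leaves labelled by edges (the tree is
-- unordered; node B C and node C B are treated alike by all notions below)
data Tree (k : ℕ) : Set where
  leaf : Fin k → Tree k
  node : Tree k → Tree k → Tree k

-- a pattern is the empty pattern (nothing) or a tree
Pattern : ℕ → Set
Pattern k = Maybe (Tree k)

edgesT : ∀ {k} → Tree k → Subset k
edgesT (leaf i) = ⁅ i ⁆
edgesT (node B C) = edgesT B ∪ edgesT C

edgesP : ∀ {k} → Pattern k → Subset k
edgesP nothing = Sub.⊥
edgesP (just A) = edgesT A

vertsT : ∀ {k} → Tree k → Subset (suc k)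
vertsT A = verts (edgesT A)

vertsP : ∀ {k} → Pattern k → Subset (suc k)
vertsP A = verts (edgesP A)

Respecting : ∀ {k} → Pattern k → Subset (suc k) → Set
Respecting A S = ∀ i → i ∈ edgesP A →
  (inject₁ i ∈ S → fsuc i ∈ S) × (fsuc i ∈ S → inject₁ i ∈ S)

-- {X, ∅} = X
join : ∀ {k} → Pattern k → Pattern k → Pattern k
join nothing Y = Y
join (just B) nothing = just B
join (just B) (just C) = just (node B C)

restrictT : ∀ {k} → Tree k → Subset (suc k) → Pattern k
restrictT (leaf i) S = if lookup S (inject₁ i) then just (leaf i) else nothing
restrictT (node B C) S = join (restrictT B S) (restrictT C S)

_↾_ : ∀ {k} → Pattern k → Subset (suc k) → Pattern k
nothing ↾ S = nothing
just A ↾ S = restrictT A S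

-- χ̄ :  ChiLE A 𝒜 m  means  χ̄_A(𝒜) ≤ m   (the minimum in the definition
-- of χ̄_{B,C} is ≤ m iff some admissible cover has cost ≤ m).

mutual
  -- one term 𝓑_i ⋈ 𝓒_i of a cover, with costs b ≥ χ̄_B(𝓑_i), c ≥ χ̄_C(𝓒_i)
  record Piece {n k : ℕ} (B C : Tree k) : Set₁ where
    inductive
    field
      𝓑 : Pred n k
      𝓒 : Pred n k
      b : ℕ
      c : ℕ
      𝓑-path : IsPathset (vertsT B) 𝓑
      𝓒-path : IsPathset (vertsT C) 𝓒
      𝓑-small : Small (edgesT B) 𝓑
      𝓒-small : Small (edgesT C) 𝓒
      𝓑-cost : ChiLET B 𝓑 b
      𝓒-cost : ChiLET C 𝓒 c

  ChiLET : ∀ {n k} → Tree k → Pred n k → ℕ → Set₁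
  ChiLET (leaf i) 𝒜 m = Lift (lsuc lzero) (CardLE (vertsT (leaf i)) 𝒜 m)
  ChiLET {n} {k} (node B C) 𝒜 m =
    Σ[ ps ∈ List (Piece B C) ]
      ( Lift (lsuc lzero) (∀ x → 𝒜 x → Any (λ p → Piece.𝓑 p x × Piece.𝓒 p x) ps)
      × Lift (lsuc lzero) (sum (map (λ p → Piece.b p + Piece.c p) ps) ≤ m))

ChiLE : ∀ {n k} → Pattern k → Pred n k → ℕ → Set₁
ChiLE nothing 𝒜 m = Lift (lsuc lzero) ⊤
ChiLE (just A) 𝒜 m = ChiLET A 𝒜 m

IsChi : ∀ {n k} → Pattern k → Pred n k → ℕ → Set₁
IsChi A 𝒜 v = ChiLE A 𝒜 v × (∀ m → ChiLE A 𝒜 m → Lift (lsuc lzero) (v ≤ m))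

restrictSet : ∀ {n k} → Pred n k → Subset (suc k) → Asg n k → Pred n k
restrictSet 𝒜 S z y = 𝒜 (merge S y z)

module Submission where

-- Proof by induction on the tree A, transporting covers.  A leaf cover of 𝒜
-- by tuples is also a cover of 𝒜|^z_S, since the vertices of the leaf lie in S.
-- For A = {B,C}, a cover 𝒜 ⊆ ⋃ᵢ 𝓑ᵢ ⋈ 𝓒ᵢ restricts termwise to a cover of 𝒜|^z_S
-- by the 𝓑ᵢ|^z_S ⋈ 𝓒ᵢ|^z_S.  When both B↾S and C↾S survive, these are again
-- admissible pieces: restriction preserves being a pathset and being small
-- (for T ⊆ S, the components of G_{B↾S} inside T are those of G_B, and the
-- fibres of 𝓑|^z_S over T are fibres of 𝓑).  When only C↾S survives, then
-- {B,C} ↾ S = C↾S and 𝒜|^z_S ⊆ ⋃ᵢ 𝓒ᵢ|^z_S, so subadditivity of χ̄ bounds the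
-- cost by Σ cᵢ ≤ Σ (bᵢ + cᵢ); the case of B↾S alone is symmetric, and when
-- neither survives A↾S = ∅ and there is nothing to show.

open import Defs
open import Data.Nat using (ℕ; suc; _≤_)
open import Data.Fin.Subset using (Subset)

open import Level using (lift; lower)
open import Data.Bool using (true; false)
open import Data.Nat using (_+_; z≤n)
open import Data.Nat.Properties using (≤-trans; ≤-reflexive; +-mono-≤; m≤m+n; m≤n+m)
open import Data.Fin using (Fin; inject₁) renaming (suc to fsuc; zero to fzero)
open import Data.Fin.Subset using (_∈_; _⊆_; _∩_; ∣_∣; inside; outside)
open import Data.Fin.Subset.Properties
  using (x∈p∪q⁻; x∈p∪q⁺; p⊆p∪q; q⊆p∪q; x∈p∩q⁻; x∈p∩q⁺; x∈⁅y⁆⇒x≡y; ∉⊥;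
         x∈∁p⇒x∉p; x∉p⇒x∈∁p; ⊆-antisym)
open import Data.Vec using ([]; _∷_; _∷ʳ_; lookup; here; there)
open import Data.Vec.Properties using ([]=⇒lookup; lookup⇒[]=)
open import Data.List using (List; []; _∷_; _++_; length; map)
import Data.List as List
open import Data.List.Properties using (length-++; map-++; map-∘)
open import Data.Nat.ListAction using (sum)
open import Data.Nat.ListAction.Properties using (sum-++)
open import Data.List.Relation.Unary.Any using (Any; here; there)
import Data.List.Relation.Unary.Any as Any
open import Data.List.Relation.Unary.Any.Properties using (map⁺; ++⁺ˡ; ++⁺ʳ; lookup-index)
open import Data.Maybe using (just; nothing)
open import Data.Product using (Σ; _×_; _,_; proj₁; proj₂)
open import Data.Sum using (_⊎_; inj₁; inj₂)
open import Data.Unit using (tt)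
open import Data.Empty using (⊥-elim)
open import Relation.Nullary using (¬_)
open import Relation.Binary.PropositionalEquality using (_≡_; refl; sym; trans; cong; subst)

chi-⊆ : ∀ {n k} (T : Tree k) {P Q : Pred n k} {a : ℕ} →
  (∀ x → Q x → P x) → ChiLET T P a → ChiLET T Q a
chi-⊆ (leaf i) Q⊆P (lift (L , len , cov)) = lift (L , len , λ x q → cov x (Q⊆P x q))
chi-⊆ (node B C) Q⊆P (ps , lift cov , cost) = ps , lift (λ x q → cov x (Q⊆P x q)) , cost

chi-weaken : ∀ {n k} (T : Tree k) {P : Pred n k} {a b : ℕ} →
  a ≤ b → ChiLET T P a → ChiLET T P b
chi-weaken (leaf i) a≤b (lift (L , len , cov)) = lift (L , ≤-trans len a≤b , cov)
chi-weaken (node B C) a≤b (ps , cov , lift cost) = ps , cov , lift (≤-trans cost a≤b)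

chi-∅ : ∀ {n k} (T : Tree k) {Q : Pred n k} → (∀ x → ¬ Q x) → ChiLET T Q 0
chi-∅ (leaf i) Q-empty = lift ([] , z≤n , λ x q → ⊥-elim (Q-empty x q))
chi-∅ (node B C) Q-empty = [] , lift (λ x q → ⊥-elim (Q-empty x q)) , lift z≤n

chi-∪ : ∀ {n k} (T : Tree k) {P R : Pred n k} {a b : ℕ} →
  ChiLET T P a → ChiLET T R b → ChiLET T (λ x → P x ⊎ R x) (a + b)
chi-∪ (leaf i) (lift (L , len , cov)) (lift (L′ , len′ , cov′)) =
  lift (L ++ L′ , ≤-trans (≤-reflexive (length-++ L)) (+-mono-≤ len len′) , cover)
  where
  cover : ∀ x → _ ⊎ _ → Any _ (L ++ L′)
  cover x (inj₁ p) = ++⁺ˡ (cov x p)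
  cover x (inj₂ r) = ++⁺ʳ L (cov′ x r)
chi-∪ (node B C) (ps , lift cov , lift cost) (ps′ , lift cov′ , lift cost′) =
  ps ++ ps′ , lift cover , lift (≤-trans (≤-reflexive total) (+-mono-≤ cost cost′))
  where
  cover : ∀ x → _ ⊎ _ → Any _ (ps ++ ps′)
  cover x (inj₁ p) = ++⁺ˡ (cov x p)
  cover x (inj₂ r) = ++⁺ʳ ps (cov′ x r)
  total : sum (map _ (ps ++ ps′)) ≡ sum (map _ ps) + sum (map _ ps′)
  total = trans (cong sum (map-++ _ ps ps′)) (sum-++ (map _ ps) _)

⋃ : ∀ {n k} {X : Set₁} (ps : List X) → (X → Pred n k) → Pred n k
⋃ ps P x = Σ (Fin (length ps)) (λ j → P (List.lookup ps j) x)

chi-⋃ : ∀ {n k} {X : Set₁} (T : Tree k) (P : X → Pred n k) (c : X → ℕ) →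
  (∀ p → ChiLET T (P p) (c p)) → (ps : List X) → ChiLET T (⋃ ps P) (sum (map c ps))
chi-⋃ T P c chi [] = chi-∅ T (λ { x (() , _) })
chi-⋃ T P c chi (p ∷ ps) = chi-⊆ T split (chi-∪ T (chi p) (chi-⋃ T P c chi ps))
  where
  split : ∀ x → ⋃ (p ∷ ps) P x → P p x ⊎ ⋃ ps P x
  split x (fzero , q) = inj₁ q
  split x (fsuc j , q) = inj₂ (j , q)

chi-cover : ∀ {n k} {X : Set₁} (T : Tree k) (P : X → Pred n k) (c : X → ℕ)
  (ps : List X) {Q : Pred n k} →
  (∀ p → ChiLET T (P p) (c p)) → (∀ x → Q x → Any (λ p → P p x) ps) →
  ChiLET T Q (sum (map c ps))
chi-cover T P c ps chi cov =
  chi-⊆ T (λ x q → Any.index (cov x q) , lookup-index (cov x q)) (chi-⋃ T P c chi ps)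

sum-mono : ∀ {X : Set₁} (ps : List X) {c d : X → ℕ} → (∀ p → c p ≤ d p) →
  sum (map c ps) ≤ sum (map d ps)
sum-mono [] c≤d = z≤n
sum-mono (p ∷ ps) c≤d = +-mono-≤ (c≤d p) (sum-mono ps c≤d)

Endpoint : ∀ {k} → Fin k → Fin (suc k) → Set
Endpoint i v = v ≡ inject₁ i ⊎ v ≡ fsuc i

-- S contains both or neither endpoint of every edge of E.  Respecting A S is
-- Closed (edgesP A) S, and UnionOfComps E T contains Closed E T.
Closed : ∀ {k} → Subset k → Subset (suc k) → Set
Closed E S = ∀ i → i ∈ E → (inject₁ i ∈ S → fsuc i ∈ S) × (fsuc i ∈ S → inject₁ i ∈ S)

closed-⊆ : ∀ {k} {E E′ : Subset k} {S : Subset (suc k)} → E′ ⊆ E → Closed E S → Closed E′ S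
closed-⊆ E′⊆E closed i i∈E′ = closed i (E′⊆E i∈E′)

closed-endpoint : ∀ {k} {E : Subset k} {S : Subset (suc k)} → Closed E S →
  ∀ {i v} → i ∈ E → Endpoint i v → (inject₁ i ∈ S → v ∈ S) × (v ∈ S → inject₁ i ∈ S)
closed-endpoint closed i∈E (inj₁ refl) = (λ s → s) , (λ s → s)
closed-endpoint closed {i} i∈E (inj₂ refl) = closed i i∈E

left-end⁻ : ∀ {k} (E : Subset k) (v : Fin (suc k)) → v ∈ (E ∷ʳ outside) →
  Σ (Fin k) (λ i → i ∈ E × v ≡ inject₁ i)
left-end⁻ [] fzero ()
left-end⁻ (inside ∷ E) fzero here = fzero , here , refl
left-end⁻ (b ∷ E) (fsuc v) (there p) with left-end⁻ E v p
... | i , i∈E , refl = fsuc i , there i∈E , refl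

left-end⁺ : ∀ {k} (E : Subset k) {i : Fin k} → i ∈ E → inject₁ i ∈ (E ∷ʳ outside)
left-end⁺ (inside ∷ E) here = here
left-end⁺ (b ∷ E) (there p) = there (left-end⁺ E p)

verts⁻ : ∀ {k} (E : Subset k) {v : Fin (suc k)} → v ∈ verts E →
  Σ (Fin k) (λ i → i ∈ E × Endpoint i v)
verts⁻ E {v} p with x∈p∪q⁻ (outside ∷ E) (E ∷ʳ outside) p
verts⁻ E {fsuc j} p | inj₁ (there j∈E) = j , j∈E , inj₂ refl
... | inj₂ q with left-end⁻ E v q
... | i , i∈E , eq = i , i∈E , inj₁ eq

verts⁺ : ∀ {k} (E : Subset k) {i : Fin k} {v : Fin (suc k)} → i ∈ E → Endpoint i v → v ∈ verts E
verts⁺ E i∈E (inj₁ refl) = x∈p∪q⁺ (inj₂ (left-end⁺ E i∈E))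
verts⁺ E i∈E (inj₂ refl) = x∈p∪q⁺ (inj₁ (there i∈E))

verts-mono : ∀ {k} {E E′ : Subset k} → E′ ⊆ E → verts E′ ⊆ verts E
verts-mono {E′ = E′} E′⊆E p with verts⁻ E′ p
... | i , i∈E′ , end = verts⁺ _ (E′⊆E i∈E′) end

verts-⊆ : ∀ {k} {E : Subset k} {S : Subset (suc k)} → Closed E S →
  (∀ {i} → i ∈ E → inject₁ i ∈ S) → verts E ⊆ S
verts-⊆ {E = E} closed left∈S p with verts⁻ E p
... | i , i∈E , end = proj₁ (closed-endpoint closed i∈E end) (left∈S i∈E)

join-edges⁻ : ∀ {k} (X Y : Pattern k) {i : Fin k} → i ∈ edgesP (join X Y) →
  i ∈ edgesP X ⊎ i ∈ edgesP Y
join-edges⁻ nothing Y p = inj₂ p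
join-edges⁻ (just B) nothing p = inj₁ p
join-edges⁻ (just B) (just C) p = x∈p∪q⁻ (edgesT B) (edgesT C) p

join-edges⁺ : ∀ {k} (X Y : Pattern k) {i : Fin k} → i ∈ edgesP X ⊎ i ∈ edgesP Y →
  i ∈ edgesP (join X Y)
join-edges⁺ nothing Y (inj₁ p) = ⊥-elim (∉⊥ p)
join-edges⁺ nothing Y (inj₂ p) = p
join-edges⁺ (just B) nothing (inj₁ p) = p
join-edges⁺ (just B) nothing (inj₂ p) = ⊥-elim (∉⊥ p)
join-edges⁺ (just B) (just C) p = x∈p∪q⁺ p

restrict-edges⁻ : ∀ {k} (B : Tree k) (S : Subset (suc k)) {i : Fin k} →
  i ∈ edgesP (restrictT B S) → i ∈ edgesT B × inject₁ i ∈ S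
restrict-edges⁻ (leaf j) S p with lookup S (inject₁ j) in eq
... | true with refl ← x∈⁅y⁆⇒x≡y j p = p , lookup⇒[]= _ S eq
... | false = ⊥-elim (∉⊥ p)
restrict-edges⁻ (node B C) S p with join-edges⁻ (restrictT B S) (restrictT C S) p
... | inj₁ q = let i∈B , s = restrict-edges⁻ B S q in p⊆p∪q (edgesT C) i∈B , s
... | inj₂ q = let i∈C , s = restrict-edges⁻ C S q in q⊆p∪q (edgesT B) _ i∈C , s

restrict-edges⁺ : ∀ {k} (B : Tree k) (S : Subset (suc k)) {i : Fin k} →
  i ∈ edgesT B → inject₁ i ∈ S → i ∈ edgesP (restrictT B S)
restrict-edges⁺ (leaf j) S p s with refl ← x∈⁅y⁆⇒x≡y j p rewrite []=⇒lookup s = p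
restrict-edges⁺ (node B C) S p s =
  join-edges⁺ (restrictT B S) (restrictT C S) (side (x∈p∪q⁻ (edgesT B) (edgesT C) p))
  where
  side : _ ⊎ _ → _ ⊎ _
  side (inj₁ q) = inj₁ (restrict-edges⁺ B S q s)
  side (inj₂ q) = inj₂ (restrict-edges⁺ C S q s)

merge-inside : ∀ {n k} {S : Subset (suc k)} {v : Fin (suc k)} (x z : Asg n k) →
  v ∈ S → merge S x z v ≡ x v
merge-inside x z s rewrite []=⇒lookup s = refl

merge-nested : ∀ {n k} {S T : Subset (suc k)} (y z′ z : Asg n k) → T ⊆ S →
  ∀ v → merge S (merge T y z′) z v ≡ merge T y (merge S z′ z) v
merge-nested {S = S} {T} y z′ z T⊆S v with lookup T v in eT | lookup S v in eS
... | true | true = refl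
... | false | true = refl
... | false | false = refl
... | true | false with () ← trans (sym ([]=⇒lookup (T⊆S (lookup⇒[]= v T eT)))) eS

-- Fibres of P|^z_S over T ⊆ S are fibres of P, so bounds on μ_T transfer.
mu-restrict : ∀ {n k} {V S T : Subset (suc k)} (z : Asg n k) {P : Pred n k} {t : ℕ} →
  T ⊆ S → IsPathset V P → MuLE P T t → MuLE (restrictSet P S z) T t
mu-restrict {S = S} {T} z {P} T⊆S P-path μ z′ with μ (merge S z′ z)
... | c , (L , len , cov) , bound = c , (L , len , cov′) , bound
  where
  cov′ : ∀ y → restrictSet P S z (merge T y z′) → Any (AgreeOn T y) L
  cov′ y py = cov y (P-path _ _ (λ v _ → merge-nested y z′ z T⊆S v) py)

agree-merge : ∀ {n k} {V S : Subset (suc k)} (x z y : Asg n k) → V ⊆ S →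
  AgreeOn V (merge S x z) y → AgreeOn V x y
agree-merge x z y V⊆S agree v p = trans (sym (merge-inside x z (V⊆S p))) (agree v p)

leftmost-transfer : ∀ {k} {S : Subset (suc k)} {E E′ : Subset k} →
  (∀ {j} → fsuc j ∈ S → j ∈ E′ → j ∈ E) →
  ∀ {v} → v ∈ S → v ∈ leftmost E → v ∈ leftmost E′
leftmost-transfer sub s here = here
leftmost-transfer sub s (there p) = there (x∉p⇒x∈∁p (λ j∈E′ → x∈∁p⇒x∉p p (sub s j∈E′)))

∩∩-⊆ : ∀ {m} {T a b a′ b′ : Subset m} →
  (∀ {v} → v ∈ T → v ∈ a → v ∈ a′) → (∀ {v} → v ∈ T → v ∈ b → v ∈ b′) →
  T ∩ (a ∩ b) ⊆ T ∩ (a′ ∩ b′)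
∩∩-⊆ {T = T} {a} {b} f g p with x∈p∩q⁻ T _ p
... | t , q with x∈p∩q⁻ a b q
... | va , vb = x∈p∩q⁺ (t , x∈p∩q⁺ (f t va , g t vb))

module Restriction {n k : ℕ} (S : Subset (suc k)) (z : Asg n k) {B B′ : Tree k}
  (B↾S : restrictT B S ≡ just B′) (resp : Respecting (just B) S) where

  edges′⁻ : ∀ {i} → i ∈ edgesT B′ → i ∈ edgesT B × inject₁ i ∈ S
  edges′⁻ p = restrict-edges⁻ B S (subst (λ X → _ ∈ edgesP X) (sym B↾S) p)

  edges′⁺ : ∀ {i v} → i ∈ edgesT B → Endpoint i v → v ∈ S → i ∈ edgesT B′
  edges′⁺ i∈B end s = subst (λ X → _ ∈ edgesP X) B↾S
    (restrict-edges⁺ B S i∈B (proj₂ (closed-endpoint resp i∈B end) s))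

  edges′⊆ : edgesT B′ ⊆ edgesT B
  edges′⊆ p = proj₁ (edges′⁻ p)

  verts′⊆S : vertsT B′ ⊆ S
  verts′⊆S = verts-⊆ (closed-⊆ edges′⊆ resp) (λ p → proj₂ (edges′⁻ p))

  verts∩S : ∀ {v} → v ∈ vertsT B → v ∈ S → v ∈ vertsT B′
  verts∩S p s with verts⁻ (edgesT B) p
  ... | i , i∈B , end = verts⁺ (edgesT B′) (edges′⁺ i∈B end s) end

  restrict-pathset : {P : Pred n k} → IsPathset (vertsT B) P →
    IsPathset (vertsT B′) (restrictSet P S z)
  restrict-pathset P-path x y agree = P-path (merge S x z) (merge S y z) agree′
    where
    agree′ : AgreeOn (vertsT B) (merge S x z) (merge S y z)
    agree′ v p with lookup S v in eq
    ... | true = agree v (verts∩S p (lookup⇒[]= v S eq))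
    ... | false = refl

  comps-transfer : ∀ {T} → UnionOfComps (edgesT B′) T → UnionOfComps (edgesT B) T
  comps-transfer {T} (T⊆V′ , T-closed) = (λ p → verts-mono edges′⊆ (T⊆V′ p)) , T-closed′
    where
    T-closed′ : Closed (edgesT B) T
    T-closed′ i i∈B =
      (λ t → proj₁ (T-closed i (edges′⁺ i∈B (inj₁ refl) (verts′⊆S (T⊆V′ t)))) t) ,
      (λ t → proj₂ (T-closed i (edges′⁺ i∈B (inj₂ refl) (verts′⊆S (T⊆V′ t)))) t)

  ncomp-transfer : ∀ {T} → T ⊆ S → ncomp (edgesT B) T ≡ ncomp (edgesT B′) T
  ncomp-transfer T⊆S = cong ∣_∣ (⊆-antisym
    (∩∩-⊆ (λ t → leftmost-transfer (λ _ → edges′⊆) (T⊆S t)) (λ t p → verts∩S p (T⊆S t)))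
    (∩∩-⊆ (λ t → leftmost-transfer (λ s j∈B → edges′⁺ j∈B (inj₂ refl) s) (T⊆S t))
          (λ _ → verts-mono edges′⊆)))

  restrict-small : {P : Pred n k} → IsPathset (vertsT B) P → Small (edgesT B) P →
    Small (edgesT B′) (restrictSet P S z)
  restrict-small {P} P-path P-small T T-comps one =
    subst (MuLE (restrictSet P S z) T) same
      (mu-restrict z {t = ncomp (edgesT B) T} T⊆S P-path
        (P-small T (comps-transfer T-comps) (subst (1 ≤_) (sym same) one)))
    where
    T⊆S : T ⊆ S
    T⊆S p = verts′⊆S (proj₁ T-comps p)
    same : ncomp (edgesT B) T ≡ ncomp (edgesT B′) T
    same = ncomp-transfer T⊆S

respect-left : ∀ {k} (B C : Tree k) {S : Subset (suc k)} →
  Respecting (just (node B C)) S → Respecting (just B) S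
respect-left B C = closed-⊆ (p⊆p∪q (edgesT C))

respect-right : ∀ {k} (B C : Tree k) {S : Subset (suc k)} →
  Respecting (just (node B C)) S → Respecting (just C) S
respect-right B C = closed-⊆ (q⊆p∪q (edgesT B) _)

-- The induction proper.  restrict-piece precedes chi-restrict in the block so
-- that its fields compute when chi-restrict covers 𝒜|^z_S by restricted pieces.
mutual
  chi-restrict-to : ∀ {n k} (S : Subset (suc k)) (z : Asg n k) {B B′ : Tree k}
    {𝒜 : Pred n k} {m : ℕ} → restrictT B S ≡ just B′ → Respecting (just B) S →
    ChiLET B 𝒜 m → ChiLET B′ (restrictSet 𝒜 S z) m
  chi-restrict-to S z {B} B↾S resp chi =
    subst (λ X → ChiLE X _ _) B↾S (chi-restrict S z B resp chi)

  restrict-piece : ∀ {n k} (S : Subset (suc k)) (z : Asg n k) {B C B′ C′ : Tree k} →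
    restrictT B S ≡ just B′ → restrictT C S ≡ just C′ →
    Respecting (just B) S → Respecting (just C) S → Piece {n} B C → Piece {n} B′ C′
  restrict-piece S z {B} {C} B↾S C↾S respB respC p = record
    { 𝓑 = restrictSet 𝓑 S z
    ; 𝓒 = restrictSet 𝓒 S z
    ; b = b
    ; c = c
    ; 𝓑-path = RB.restrict-pathset 𝓑-path
    ; 𝓒-path = RC.restrict-pathset 𝓒-path
    ; 𝓑-small = RB.restrict-small 𝓑-path 𝓑-small
    ; 𝓒-small = RC.restrict-small 𝓒-path 𝓒-small
    ; 𝓑-cost = chi-restrict-to S z B↾S respB 𝓑-cost
    ; 𝓒-cost = chi-restrict-to S z C↾S respC 𝓒-cost
    }
    where
    open Piece p
    module RB = Restriction S z {B} B↾S respB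
    module RC = Restriction S z {C} C↾S respC

  chi-restrict : ∀ {n k} (S : Subset (suc k)) (z : Asg n k) (A : Tree k) {𝒜 : Pred n k} {m : ℕ} →
    Respecting (just A) S → ChiLET A 𝒜 m → ChiLE (restrictT A S) (restrictSet 𝒜 S z) m
  chi-restrict S z (leaf i) resp (lift (L , len , cov)) with lookup S (inject₁ i) in eq
  -- the leaf survives: its vertices lie in S, so the same tuples cover 𝒜|^z_S
  ... | true = lift (L , len , λ x ax → Any.map (agree-merge x z _ leaf⊆S) (cov _ ax))
    where
    leaf⊆S : vertsT (leaf i) ⊆ S
    leaf⊆S = verts-⊆ resp (λ p →
      subst (λ j → inject₁ j ∈ S) (sym (x∈⁅y⁆⇒x≡y i p)) (lookup⇒[]= _ S eq))
  ... | false = lift tt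
  chi-restrict S z (node B C) resp (ps , lift cov , lift cost)
    with restrictT B S in B↾S | restrictT C S in C↾S
  ... | nothing | nothing = lift tt
  ... | just B′ | just C′ =
    map (restrict-piece S z B↾S C↾S (respect-left B C resp) (respect-right B C resp)) ps ,
    lift (λ x ax → map⁺ (cov _ ax)) ,
    lift (≤-trans (≤-reflexive (cong sum (sym (map-∘ ps)))) cost)
  ... | just B′ | nothing =
    chi-weaken B′ (≤-trans (sum-mono ps (λ p → m≤m+n _ _)) cost)
      (chi-cover B′ (λ p → restrictSet (Piece.𝓑 p) S z) Piece.b ps
        (λ p → chi-restrict-to S z B↾S (respect-left B C resp) (Piece.𝓑-cost p))
        (λ x ax → Any.map proj₁ (cov _ ax)))
  ... | nothing | just C′ =
    chi-weaken C′ (≤-trans (sum-mono ps (λ p → m≤n+m _ _)) cost)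
      (chi-cover C′ (λ p → restrictSet (Piece.𝓒 p) S z) Piece.c ps
        (λ p → chi-restrict-to S z C↾S (respect-right B C resp) (Piece.𝓒-cost p))
        (λ x ax → Any.map proj₂ (cov _ ax)))

chi-restrict-pattern : ∀ {n k} (S : Subset (suc k)) (z : Asg n k) (A : Pattern k)
  {𝒜 : Pred n k} {m : ℕ} → Respecting A S → ChiLE A 𝒜 m → ChiLE (A ↾ S) (restrictSet 𝒜 S z) m
chi-restrict-pattern S z nothing resp chi = lift tt
chi-restrict-pattern S z (just A) resp chi = chi-restrict S z A resp chi

lemma10p4 : (n k : ℕ) → 1 ≤ n → 2 ≤ k →
    (A : Pattern k) (𝒜 : Pred n k) → IsPathset (vertsP A) 𝒜 →
    (S : Subset (suc k)) → Respecting A S → (z : Asg n k) →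
    (v w : ℕ) → IsChi (A ↾ S) (restrictSet 𝒜 S z) v → IsChi A 𝒜 w → v ≤ w
lemma10p4 n k _ _ A 𝒜 _ S resp z v w (_ , v-least) (w-bound , _) =
  lower (v-least w (chi-restrict-pattern S z A resp w-bound))
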